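{- Let $A$ be a meet-complemented lattice in which $\Diamond a$ exists for every $a\in A$. If $Da$ exists for every $a\in A$, then $\Diamond\neg a\le Da$ for every $a\in A$.
   Context: A meet-complemented lattice is a lattice $(A,\wedge,\vee)$, not necessarily distributive, such that for every $a\in A$ the element $\neg a=\max\{b\in A: a\wedge b\le c\text{ for all }c\in A\}$ exists; it is bounded, with least element $0$ and greatest element $1$. For $a\in A$, $\Diamond a$ denotes $\min\{b\in A: \neg a\vee b=1\}$ and $Da$ denotes the least $b\in A$ with $a\vee b=1$, when these exist. -}

module Defs where

open import Level using (Level; _⊔_)
open import Data.Product using (Σ; _×_)
open import Relation.Binary.Lattice using (BoundedLattice)

module _ {c ℓ₁ ℓ₂ : Level} (A : BoundedLattice c ℓ₁ ℓ₂) where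
  open BoundedLattice A

  IsMax : ∀ {p} → (Carrier → Set p) → Carrier → Set (c ⊔ ℓ₂ ⊔ p)
  IsMax P x = P x × (∀ y → P y → y ≤ x)

  IsMin : ∀ {p} → (Carrier → Set p) → Carrier → Set (c ⊔ ℓ₂ ⊔ p)
  IsMin P x = P x × (∀ y → P y → x ≤ y)

  IsMeetComplement : (Carrier → Carrier) → Set (c ⊔ ℓ₂)
  IsMeetComplement neg = ∀ a → IsMax (λ b → ∀ z → a ∧ b ≤ z) (neg a)

  IsDiamond : (Carrier → Carrier) → (Carrier → Carrier) → Set (c ⊔ ℓ₁ ⊔ ℓ₂)
  IsDiamond neg dia = ∀ a → IsMin (λ b → (neg a ∨ b) ≈ ⊤) (dia a)

  IsDual : (Carrier → Carrier) → Set (c ⊔ ℓ₁ ⊔ ℓ₂)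
  IsDual d = ∀ a → IsMin (λ b → (a ∨ b) ≈ ⊤) (d a)

module Submission where

-- In a meet-complemented lattice every element lies below its
-- double complement: a ∧ ¬a is a least element, so ¬a ∧ a is too, and a is
-- therefore below the largest b with ¬a ∧ b least, namely ¬¬a.  Since
-- a ∨ Da = 1 and a ≤ ¬¬a, also ¬¬a ∨ Da = 1.  Hence Da belongs to the set
-- { b : ¬(¬a) ∨ b = 1 } whose minimum is ◇¬a, giving ◇¬a ≤ Da.

open import Defs
open import Level using (Level)
open import Relation.Binary.Lattice using (BoundedLattice)
open import Data.Product using (proj₁; proj₂)

module _ {c ℓ₁ ℓ₂ : Level} (A : BoundedLattice c ℓ₁ ℓ₂) where
  open BoundedLattice A

  join-top-mono : ∀ {x x′ b} → x ≤ x′ → (x ∨ b) ≈ ⊤ → (x′ ∨ b) ≈ ⊤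
  join-top-mono {x} {x′} {b} x≤x′ x∨b≈⊤ = antisym (maximum _) ⊤≤x′∨b
    where
    x∨b≤x′∨b : x ∨ b ≤ x′ ∨ b
    x∨b≤x′∨b = ∨-least (trans x≤x′ (x≤x∨y x′ b)) (y≤x∨y x′ b)

    ⊤≤x′∨b : ⊤ ≤ x′ ∨ b
    ⊤≤x′∨b = trans (reflexive (Eq.sym x∨b≈⊤)) x∨b≤x′∨b

  -- In a meet-complemented lattice every element is below its double
  -- complement, because ¬a ∧ a ≤ a ∧ ¬a is a least element.
  ≤-double-complement : (neg : Carrier → Carrier) → IsMeetComplement A neg
                      → ∀ a → a ≤ neg (neg a)
  ≤-double-complement neg negP a = proj₂ (negP (neg a)) a ¬a∧a-least
    where
    ¬a∧a-least : ∀ z → neg a ∧ a ≤ z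
    ¬a∧a-least z = trans (∧-greatest (x∧y≤y (neg a) a) (x∧y≤x (neg a) a))
                         (proj₁ (negP a) z)

proposition8 : {c ℓ₁ ℓ₂ : Level} (A : BoundedLattice c ℓ₁ ℓ₂)
    (neg : BoundedLattice.Carrier A → BoundedLattice.Carrier A) → IsMeetComplement A neg
    → (dia : BoundedLattice.Carrier A → BoundedLattice.Carrier A) → IsDiamond A neg dia
    → (d : BoundedLattice.Carrier A → BoundedLattice.Carrier A) → IsDual A d
    → ∀ a → BoundedLattice._≤_ A (dia (neg a)) (d a)
proposition8 A neg negP dia diaP d dP a = proj₂ (diaP (neg a)) (d a) ¬¬a∨Da≈⊤
  where
  open BoundedLattice A using (_∨_; _≈_; ⊤)

  ¬¬a∨Da≈⊤ : (neg (neg a) ∨ d a) ≈ ⊤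
  ¬¬a∨Da≈⊤ = join-top-mono A (≤-double-complement A neg negP a) (proj₁ (dP a))
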